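{- Let $\alpha$ be a dotted composition which is a column (all of its non-dotted entries equal $1$), with fermionic degree $m_\alpha$. Then $$S(L_\alpha)=(-1)^{\ell(\alpha)+\binom{m_\alpha}{2}}\sum_{\beta}L_\beta,$$ where the sum is over all maximal dotted compositions $\beta$ such that $\beta\trianglerighteq\mathrm{Rev}(\alpha)$.
   Context: Variables: commuting $x_1,x_2,\dots$ and anticommuting $\theta_1,\theta_2,\dots$. A dotted composition is a finite sequence $\alpha=(\alpha_1,\dots,\alpha_l)$ with entries either positive integers (non-dotted) or dotted nonnegative integers $\dot0,\dot1,\dots$; $\ell(\alpha)=l$, $\eta_i=1$ if $\alpha_i$ dotted else $0$, $m_\alpha$ = number of dotted entries. $M_\alpha=\sum_{i_1<\cdots<i_l}\theta_{i_1}^{\eta_1}\cdots\theta_{i_l}^{\eta_l}x_{i_1}^{\alpha_1}\cdots x_{i_l}^{\alpha_l}$, $M_\emptyset=1$. The order $\preccurlyeq$ is the reflexive–transitive closure of: $\beta\preccurlyeq\alpha$ if $\alpha$ is obtained from $\beta$ by replacing two adjacent non-dotted parts by their sum; $L_\alpha=\sum_{\beta\preccurlyeq\alpha}M_\beta$. The order $\trianglelefteq$ is the reflexive–transitive closure of: $\beta\trianglelefteq\alpha$ if $\alpha$ is obtained from $\beta$ by replacing two adjacent parts, at most one dotted, by their sum (dotted iff one of them is); $\gamma\trianglerighteq\beta$ means $\beta\trianglelefteq\gamma$. $\mathrm{Rev}(\alpha)=(\alpha_l,\dots,\alpha_1)$. A dotted composition is maximal if it has no two consecutive non-dotted entries.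 The antipode $S$ of the Hopf algebra $\mathrm{sQSym}$ (span of the $M_\alpha$) is the linear map with $S(M_\alpha)=(-1)^{\ell(\alpha)+\binom{m_\alpha}{2}}\sum_{\gamma\trianglerighteq\mathrm{Rev}(\alpha)}M_\gamma$. -}

module Defs where

open import Data.Nat using (ℕ; zero; suc; _+_)
import Data.Nat as ℕ
open import Data.Nat.Combinatorics using (_C_)
open import Data.Integer as ℤ using (ℤ)
open import Data.List using (List; []; _∷_; length; reverse; map; concatMap; _++_)
open import Data.List.Properties using (≡-dec)
open import Data.List.Membership.Propositional using (_∈_)
open import Data.List.Relation.Unary.Unique.Propositional using (Unique)
open import Data.List.Relation.Unary.All using (All)
open import Data.Product using (_×_; _,_)
open import Data.Unit using (⊤)
open import Data.Empty using (⊥)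
open import Function.Bundles using (_⇔_)
open import Relation.Nullary using (Dec; yes; no)
open import Relation.Nullary.Decidable using (map′)
open import Relation.Binary.PropositionalEquality using (_≡_; refl; cong)
open import Relation.Binary.Construct.Closure.ReflexiveTransitive using (Star)

-- Dotted compositions
--   nd n  : the NON-dotted part with value (suc n)  (a positive integer)
--   dt k  : the DOTTED part with value k            (k = 0,1,2,...)

data Part : Set where
  nd : ℕ → Part
  dt : ℕ → Part

DComp : Set
DComp = List Part

val : Part → ℕ
val (nd n) = suc n
val (dt k) = k

isDotted : Part → ℕ
isDotted (nd _) = 0
isDotted (dt _) = 1

ℓ : DComp → ℕ
ℓ = length

mDot : DComp → ℕ
mDot [] = 0
mDot (p ∷ α) = isDotted p + mDot α

Rev : DComp → DComp
Rev = reverse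

data _≺₁_ : DComp → DComp → Set where
  here  : ∀ {a b rest} → (nd a ∷ nd b ∷ rest) ≺₁ (nd (suc (a + b)) ∷ rest)
  there : ∀ {p β α} → β ≺₁ α → (p ∷ β) ≺₁ (p ∷ α)

_≼_ : DComp → DComp → Set
_≼_ = Star _≺₁_

-- The order ⊴ : β ⊲₁ α iff α is obtained from β by replacing two adjacent
-- parts, at most one dotted, by their sum (dotted iff one of them is).
-- (values: (a+1)+(b+1) = (a+b+1)+1 ; (a+1)+k ; k+(a+1))

data _⊲₁_ : DComp → DComp → Set where
  here-nn : ∀ {a b rest} → (nd a ∷ nd b ∷ rest) ⊲₁ (nd (suc (a + b)) ∷ rest)
  here-nd : ∀ {a k rest} → (nd a ∷ dt k ∷ rest) ⊲₁ (dt (suc a + k) ∷ rest)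
  here-dn : ∀ {k a rest} → (dt k ∷ nd a ∷ rest) ⊲₁ (dt (k + suc a) ∷ rest)
  there   : ∀ {p β α} → β ⊲₁ α → (p ∷ β) ⊲₁ (p ∷ α)

_⊴_ : DComp → DComp → Set
_⊴_ = Star _⊲₁_

Maximal : DComp → Set
Maximal (nd _ ∷ nd _ ∷ _) = ⊥
Maximal (_ ∷ β) = Maximal β
Maximal [] = ⊤

ColumnPart : Part → Set
ColumnPart (nd n) = n ≡ 0
ColumnPart (dt _) = ⊤

Column : DComp → Set
Column = All ColumnPart

-- sQSym as the free ℤ-module on the basis {M_α}: an element is a formal
-- finite ℤ-linear combination of the M_α, compared coefficientwise.

_≟P_ : (p q : Part) → Dec (p ≡ q)
nd m ≟P nd n = map′ (cong nd) (λ { refl → refl }) (m ℕ.≟ n)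
dt m ≟P dt n = map′ (cong dt) (λ { refl → refl }) (m ℕ.≟ n)
nd _ ≟P dt _ = no (λ ())
dt _ ≟P nd _ = no (λ ())

_≟D_ : (α β : DComp) → Dec (α ≡ β)
_≟D_ = ≡-dec _≟P_

SQSym : Set
SQSym = List (ℤ × DComp)

coeff : SQSym → DComp → ℤ
coeff [] δ = ℤ.0ℤ
coeff ((c , α) ∷ x) δ with α ≟D δ
... | yes _ = c ℤ.+ coeff x δ
... | no  _ = coeff x δ

_≈_ : SQSym → SQSym → Set
x ≈ y = ∀ δ → coeff x δ ≡ coeff y δ

scale : ℤ → SQSym → SQSym
scale c = map (λ { (d , α) → (c ℤ.* d , α) })

M : DComp → SQSym
M α = (ℤ.1ℤ , α) ∷ []

sumM : List DComp → SQSym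
sumM = concatMap M

-- A finite set of dotted compositions given by an enumeration without
-- repetition of exactly the elements satisfying P.

record Enum (P : DComp → Set) : Set where
  field
    elems    : List DComp
    unique   : Unique elems
    complete : ∀ γ → (γ ∈ elems) ⇔ P γ
open Enum public

sgn : ℕ → ℤ
sgn n = ℤ.-1ℤ ℤ.^ n

sign : DComp → ℤ
sign α = sgn (ℓ α + mDot α C 2)

L : (α : DComp) → Enum (λ β → β ≼ α) → SQSym
L α E = sumM (elems E)

S : (up : (β : DComp) → Enum (λ γ → Rev β ⊴ γ)) → SQSym → SQSym
S up = concatMap (λ { (c , β) → scale (c ℤ.* sign β) (sumM (elems (up β))) })

-- A column α has no part that is a sum of two non-dotted parts, so L_α = M_α and
-- S(L_α) = sign α · Σ_{γ ⊵ Rev α} M_γ.  Merging every maximal run of non-dotted parts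
-- sends γ to the unique maximal composition above it in ≼; conversely, if β ⊵ Rev α
-- then each non-dotted part of β is a block of 1's of the column Rev α, so splitting
-- it keeps the composition ⊵ Rev α.  Hence the sets {γ ⊵ Rev α} are partitioned by
-- the down-sets {δ ≼ β} of the maximal β ⊵ Rev α, and Σ_γ M_γ = Σ_β L_β.
module Submission where

open import Defs
open import Data.List using (concatMap)
open import Data.Product using (_×_)

open import Data.Nat using (ℕ; zero; suc; _+_)
open import Data.Nat.Properties using (+-suc; +-assoc)
import Data.Integer as ℤ
import Data.Integer.Properties as ℤ
open import Data.List using ([]; _∷_; _++_)
open import Data.List.Properties using (++-identityʳ)
open import Data.List.Membership.Propositional using (_∈_; _∉_)
open import Data.List.Membership.DecPropositional _≟D_ using (_∈?_)
open import Data.List.Relation.Unary.Any using (here; there)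
import Data.List.Relation.Unary.Any.Properties as Any
open import Data.List.Relation.Unary.All as All using ([]; _∷_)
open import Data.List.Relation.Unary.Unique.Propositional using (Unique)
open import Data.List.Relation.Unary.AllPairs using (_∷_)
open import Data.Product using (∃-syntax; _,_)
open import Data.Unit using (tt)
open import Data.Empty using (⊥-elim)
open import Function.Bundles using (Equivalence)
open import Relation.Nullary using (¬_; yes; no)
open import Relation.Binary.PropositionalEquality
  using (_≡_; _≢_; refl; sym; trans; cong; cong₂; subst; module ≡-Reasoning)
open import Relation.Binary.Construct.Closure.ReflexiveTransitive
  using (ε; _◅_; _◅◅_; gmap)

open ≡-Reasoning

coeff-++ : ∀ x y δ → coeff (x ++ y) δ ≡ coeff x δ ℤ.+ coeff y δ
coeff-++ [] y δ = sym (ℤ.+-identityˡ _)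
coeff-++ ((c , α) ∷ x) y δ with α ≟D δ
... | yes _ = trans (cong (λ z → c ℤ.+ z) (coeff-++ x y δ)) (sym (ℤ.+-assoc c _ _))
... | no  _ = coeff-++ x y δ

coeff-scale : ∀ c x δ → coeff (scale c x) δ ≡ c ℤ.* coeff x δ
coeff-scale c [] δ = sym (ℤ.*-zeroʳ c)
coeff-scale c ((d , α) ∷ x) δ with α ≟D δ
... | yes _ = trans (cong (λ z → c ℤ.* d ℤ.+ z) (coeff-scale c x δ)) (sym (ℤ.*-distribˡ-+ c d _))
... | no  _ = coeff-scale c x δ

scale-cong : ∀ c {x y} → x ≈ y → scale c x ≈ scale c y
scale-cong c {x} {y} x≈y δ = begin
  coeff (scale c x) δ  ≡⟨ coeff-scale c x δ ⟩
  c ℤ.* coeff x δ      ≡⟨ cong (c ℤ.*_) (x≈y δ) ⟩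
  c ℤ.* coeff y δ      ≡⟨ coeff-scale c y δ ⟨
  coeff (scale c y) δ  ∎

coeff-M-self : ∀ δ → coeff (M δ) δ ≡ ℤ.1ℤ
coeff-M-self δ with δ ≟D δ
... | yes _ = refl
... | no δ≢δ = ⊥-elim (δ≢δ refl)

coeff-M-≢ : ∀ {β δ} → β ≢ δ → coeff (M β) δ ≡ ℤ.0ℤ
coeff-M-≢ {β} {δ} β≢δ with β ≟D δ
... | yes β≡δ = ⊥-elim (β≢δ β≡δ)
... | no _ = refl

module _ (F : DComp → SQSym) {δ : DComp} where

  coeff-concatMap-zero : ∀ {βs} → (∀ {β} → β ∈ βs → coeff (F β) δ ≡ ℤ.0ℤ) →
                         coeff (concatMap F βs) δ ≡ ℤ.0ℤ
  coeff-concatMap-zero {[]} _ = refl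
  coeff-concatMap-zero {β ∷ βs} vanish = begin
    coeff (F β ++ concatMap F βs) δ                ≡⟨ coeff-++ (F β) _ δ ⟩
    coeff (F β) δ ℤ.+ coeff (concatMap F βs) δ     ≡⟨ cong₂ ℤ._+_ (vanish (here refl))
                                                        (coeff-concatMap-zero λ β′∈ → vanish (there β′∈)) ⟩
    ℤ.0ℤ                                           ∎

  coeff-concatMap-single : ∀ {βs β} → Unique βs → β ∈ βs →
                           (∀ {β′} → β′ ∈ βs → β′ ≢ β → coeff (F β′) δ ≡ ℤ.0ℤ) →
                           coeff (concatMap F βs) δ ≡ coeff (F β) δ
  coeff-concatMap-single {β ∷ βs} (β∉βs ∷ _) (here refl) vanish = begin
    coeff (F β ++ concatMap F βs) δ                ≡⟨ coeff-++ (F β) _ δ ⟩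
    coeff (F β) δ ℤ.+ coeff (concatMap F βs) δ     ≡⟨ cong (λ z → coeff (F β) δ ℤ.+ z) (coeff-concatMap-zero
                                                        λ β′∈ → vanish (there β′∈) λ { refl → All.lookup β∉βs β′∈ refl }) ⟩
    coeff (F β) δ ℤ.+ ℤ.0ℤ                         ≡⟨ ℤ.+-identityʳ _ ⟩
    coeff (F β) δ                                  ∎
  coeff-concatMap-single {β′ ∷ βs} {β} (β′∉βs ∷ u) (there β∈) vanish = begin
    coeff (F β′ ++ concatMap F βs) δ               ≡⟨ coeff-++ (F β′) _ δ ⟩
    coeff (F β′) δ ℤ.+ coeff (concatMap F βs) δ    ≡⟨ cong₂ ℤ._+_ (vanish (here refl) (All.lookup β′∉βs β∈))
                                                        (coeff-concatMap-single u β∈ (λ β″∈ → vanish (there β″∈))) ⟩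
    ℤ.0ℤ ℤ.+ coeff (F β) δ                         ≡⟨ ℤ.+-identityˡ _ ⟩
    coeff (F β) δ                                  ∎

coeff-sumM-∉ : ∀ {βs δ} → δ ∉ βs → coeff (sumM βs) δ ≡ ℤ.0ℤ
coeff-sumM-∉ {βs} {δ} δ∉ = coeff-concatMap-zero M {δ} {βs} λ {β} β∈ → coeff-M-≢ {β} λ { refl → δ∉ β∈ }

coeff-sumM-∈ : ∀ {βs δ} → Unique βs → δ ∈ βs → coeff (sumM βs) δ ≡ ℤ.1ℤ
coeff-sumM-∈ {δ = δ} u δ∈ =
  trans (coeff-concatMap-single M u δ∈ (λ {β} _ → coeff-M-≢ {β})) (coeff-M-self δ)

module _ {P : DComp → Set} (E : Enum P) where

  elems-sound : ∀ {γ} → γ ∈ elems E → P γ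
  elems-sound {γ} = Equivalence.to (complete E γ)

  elems-complete : ∀ {γ} → P γ → γ ∈ elems E
  elems-complete {γ} = Equivalence.from (complete E γ)

  coeff-enum-holds : ∀ {δ} → P δ → coeff (sumM (elems E)) δ ≡ ℤ.1ℤ
  coeff-enum-holds p = coeff-sumM-∈ (unique E) (elems-complete p)

  coeff-enum-fails : ∀ {δ} → ¬ P δ → coeff (sumM (elems E)) δ ≡ ℤ.0ℤ
  coeff-enum-fails ¬p = coeff-sumM-∉ λ δ∈ → ¬p (elems-sound δ∈)

  enum-singleton : ∀ {α} → P α → (∀ {β} → P β → β ≡ α) → elems E ≡ α ∷ []
  enum-singleton {α} pα only with elems E | unique E | elems-complete pα | elems-sound
  ... | β ∷ [] | _ | _ | sound = cong (_∷ []) (only (sound (here refl)))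
  ... | β ∷ β′ ∷ _ | β∉ ∷ _ | _ | sound =
    ⊥-elim (All.lookup β∉ (here refl) (trans (only (sound (here refl))) (sym (only (sound (there (here refl)))))))

sumM-partition : ∀ {P Q : DComp → Set} {R : DComp → DComp → Set}
  (E : Enum P) (B : Enum Q) (F : ∀ β → Enum (R β)) →
  (∀ {δ} → P δ → ∃[ β ] Q β × R β δ) →
  (∀ {β δ} → Q β → R β δ → P δ) →
  (∀ {β β′ δ} → Q β → R β δ → Q β′ → R β′ δ → β ≡ β′) →
  sumM (elems E) ≈ concatMap (λ β → sumM (elems (F β))) (elems B)
sumM-partition E B F cover sound functional δ with δ ∈? elems E
... | no δ∉ = trans (coeff-sumM-∉ δ∉) (sym (coeff-concatMap-zero _ λ β∈ →
                coeff-enum-fails (F _) λ r → δ∉ (elems-complete E (sound (elems-sound B β∈) r))))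
... | yes δ∈ with cover (elems-sound E δ∈)
...   | β , q , r = begin
  coeff (sumM (elems E)) δ                                   ≡⟨ coeff-sumM-∈ (unique E) δ∈ ⟩
  ℤ.1ℤ                                                       ≡⟨ coeff-enum-holds (F β) r ⟨
  coeff (sumM (elems (F β))) δ                               ≡⟨ coeff-concatMap-single _ (unique B)
                                                                  (elems-complete B q) others ⟨
  coeff (concatMap (λ β → sumM (elems (F β))) (elems B)) δ   ∎
  where
  others : ∀ {β′} → β′ ∈ elems B → β′ ≢ β → coeff (sumM (elems (F β′))) δ ≡ ℤ.0ℤ
  others β′∈ β′≢β = coeff-enum-fails (F _) λ r′ → β′≢β (functional (elems-sound B β′∈) r′ q r)

≺₁⇒⊲₁ : ∀ {β α} → β ≺₁ α → β ⊲₁ α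
≺₁⇒⊲₁ here = here-nn
≺₁⇒⊲₁ (there s) = there (≺₁⇒⊲₁ s)

≼⇒⊴ : ∀ {β α} → β ≼ α → β ⊴ α
≼⇒⊴ = gmap (λ γ → γ) ≺₁⇒⊲₁

∷-≼ : ∀ p {β α} → β ≼ α → (p ∷ β) ≼ (p ∷ α)
∷-≼ p = gmap (p ∷_) there

∷-⊴ : ∀ p {β α} → β ⊴ α → (p ∷ β) ⊴ (p ∷ α)
∷-⊴ p = gmap (p ∷_) there

consMerge : ℕ → DComp → DComp
consMerge a (nd b ∷ γ) = nd (suc (a + b)) ∷ γ
consMerge a γ = nd a ∷ γ

mergeRuns : DComp → DComp
mergeRuns [] = []
mergeRuns (nd a ∷ γ) = consMerge a (mergeRuns γ)
mergeRuns (dt k ∷ γ) = dt k ∷ mergeRuns γ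

consMerge-consMerge : ∀ a b γ → consMerge a (consMerge b γ) ≡ consMerge (suc (a + b)) γ
consMerge-consMerge a b [] = refl
consMerge-consMerge a b (dt k ∷ γ) = refl
consMerge-consMerge a b (nd c ∷ γ) = cong (λ n → nd (suc n) ∷ γ) (begin
  a + suc (b + c)    ≡⟨ +-suc a (b + c) ⟩
  suc (a + (b + c))  ≡⟨ cong suc (+-assoc a b c) ⟨
  suc (a + b + c)    ∎)

mergeRuns-≺₁ : ∀ {β α} → β ≺₁ α → mergeRuns β ≡ mergeRuns α
mergeRuns-≺₁ (here {a} {b} {γ}) = consMerge-consMerge a b (mergeRuns γ)
mergeRuns-≺₁ (there {nd a} s) = cong (consMerge a) (mergeRuns-≺₁ s)
mergeRuns-≺₁ (there {dt k} s) = cong (dt k ∷_) (mergeRuns-≺₁ s)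

mergeRuns-≼ : ∀ {β α} → β ≼ α → mergeRuns β ≡ mergeRuns α
mergeRuns-≼ ε = refl
mergeRuns-≼ (s ◅ ss) = trans (mergeRuns-≺₁ s) (mergeRuns-≼ ss)

mergeRuns-maximal : ∀ {β} → Maximal β → mergeRuns β ≡ β
mergeRuns-maximal {[]} _ = refl
mergeRuns-maximal {nd a ∷ []} _ = refl
mergeRuns-maximal {nd a ∷ dt k ∷ β} m = cong (nd a ∷_) (mergeRuns-maximal {dt k ∷ β} m)
mergeRuns-maximal {dt k ∷ β} m = cong (dt k ∷_) (mergeRuns-maximal m)

Maximal-consMerge : ∀ a γ → Maximal γ → Maximal (consMerge a γ)
Maximal-consMerge a [] _ = tt
Maximal-consMerge a (nd b ∷ []) _ = tt
Maximal-consMerge a (nd b ∷ dt k ∷ γ) m = m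
Maximal-consMerge a (dt k ∷ γ) m = m

Maximal-mergeRuns : ∀ β → Maximal (mergeRuns β)
Maximal-mergeRuns [] = tt
Maximal-mergeRuns (nd a ∷ β) = Maximal-consMerge a (mergeRuns β) (Maximal-mergeRuns β)
Maximal-mergeRuns (dt k ∷ β) = Maximal-mergeRuns β

≼-consMerge : ∀ a γ → (nd a ∷ γ) ≼ consMerge a γ
≼-consMerge a [] = ε
≼-consMerge a (nd b ∷ γ) = here ◅ ε
≼-consMerge a (dt k ∷ γ) = ε

≼-mergeRuns : ∀ β → β ≼ mergeRuns β
≼-mergeRuns [] = ε
≼-mergeRuns (nd a ∷ β) = ∷-≼ (nd a) (≼-mergeRuns β) ◅◅ ≼-consMerge a (mergeRuns β)
≼-mergeRuns (dt k ∷ β) = ∷-≼ (dt k) (≼-mergeRuns β)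

maximal-above-unique : ∀ {δ β} → δ ≼ β → Maximal β → β ≡ mergeRuns δ
maximal-above-unique {δ} {β} δ≼β m = trans (sym (mergeRuns-maximal m)) (sym (mergeRuns-≼ δ≼β))

-- Groups c γ: γ arises from the column c by summing consecutive blocks, each block
-- being 1^a (a non-dotted part) or 1^a k̇ 1^b (a dotted part).  The constructors build
-- the head part of γ from the head of c; for a column c this is exactly c ⊴ γ.
data Groups : DComp → DComp → Set where
  []        : Groups [] []
  nd-start  : ∀ {c γ} → Groups c γ → Groups (nd 0 ∷ c) (nd 0 ∷ γ)
  nd-extend : ∀ {c n γ} → Groups c (nd n ∷ γ) → Groups (nd 0 ∷ c) (nd (suc n) ∷ γ)
  dt-start  : ∀ {c k γ} → Groups c γ → Groups (dt k ∷ c) (dt k ∷ γ)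
  dt-extend : ∀ {c k γ} → Groups c (dt k ∷ γ) → Groups (nd 0 ∷ c) (dt (suc k) ∷ γ)
  dt-absorb : ∀ {c k n γ} → Groups c (nd n ∷ γ) → Groups (dt k ∷ c) (dt (k + suc n) ∷ γ)

Groups-tail : ∀ {β α} → (∀ {c} → Groups c β → Groups c α) →
              ∀ {c p} → Groups c (p ∷ β) → Groups c (p ∷ α)
Groups-tail f (nd-start g) = nd-start (f g)
Groups-tail f (nd-extend g) = nd-extend (Groups-tail f g)
Groups-tail f (dt-start g) = dt-start (f g)
Groups-tail f (dt-extend g) = dt-extend (Groups-tail f g)
Groups-tail f (dt-absorb g) = dt-absorb (Groups-tail f g)

Groups-merge-nn : ∀ {c a b γ} → Groups c (nd a ∷ nd b ∷ γ) → Groups c (nd (suc (a + b)) ∷ γ)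
Groups-merge-nn (nd-start g) = nd-extend g
Groups-merge-nn (nd-extend g) = nd-extend (Groups-merge-nn g)

Groups-merge-nd : ∀ {c a k γ} → Groups c (nd a ∷ dt k ∷ γ) → Groups c (dt (suc a + k) ∷ γ)
Groups-merge-nd (nd-start g) = dt-extend g
Groups-merge-nd (nd-extend g) = dt-extend (Groups-merge-nd g)

Groups-merge-dn : ∀ {c k a γ} → Groups c (dt k ∷ nd a ∷ γ) → Groups c (dt (k + suc a) ∷ γ)
Groups-merge-dn (dt-start g) = dt-absorb g
Groups-merge-dn (dt-extend g) = dt-extend (Groups-merge-dn g)
Groups-merge-dn {c} {a = a} {γ} (dt-absorb {k = k} {n} g) =
  subst (λ m → Groups c (dt m ∷ γ)) (sym reassoc) (dt-absorb (Groups-merge-nn g))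
  where
  reassoc : k + suc n + suc a ≡ k + suc (suc (n + a))
  reassoc = trans (+-assoc k (suc n) (suc a)) (cong (λ m → k + suc m) (+-suc n a))

Groups-⊲₁ : ∀ {c γ γ′} → Groups c γ → γ ⊲₁ γ′ → Groups c γ′
Groups-⊲₁ g here-nn = Groups-merge-nn g
Groups-⊲₁ g here-nd = Groups-merge-nd g
Groups-⊲₁ g here-dn = Groups-merge-dn g
Groups-⊲₁ g (there s) = Groups-tail (λ g′ → Groups-⊲₁ g′ s) g

Groups-split-nn : ∀ a {b c γ} → Groups c (nd (suc (a + b)) ∷ γ) → Groups c (nd a ∷ nd b ∷ γ)
Groups-split-nn zero (nd-extend g) = nd-start g
Groups-split-nn (suc a) (nd-extend g) = nd-extend (Groups-split-nn a g)

Groups-≺₁ : ∀ {c δ β} → Groups c β → δ ≺₁ β → Groups c δ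
Groups-≺₁ g (here {a}) = Groups-split-nn a g
Groups-≺₁ g (there s) = Groups-tail (λ g′ → Groups-≺₁ g′ s) g

Groups-⊴ : ∀ {c β γ} → Groups c β → β ⊴ γ → Groups c γ
Groups-⊴ g ε = g
Groups-⊴ g (s ◅ ss) = Groups-⊴ (Groups-⊲₁ g s) ss

Groups-≼ : ∀ {c δ β} → Groups c β → δ ≼ β → Groups c δ
Groups-≼ g ε = g
Groups-≼ g (s ◅ ss) = Groups-≺₁ (Groups-≼ g ss) s

Groups⇒⊴ : ∀ {c γ} → Groups c γ → c ⊴ γ
Groups⇒⊴ [] = ε
Groups⇒⊴ (nd-start g) = ∷-⊴ _ (Groups⇒⊴ g)
Groups⇒⊴ (nd-extend g) = ∷-⊴ _ (Groups⇒⊴ g) ◅◅ (here-nn ◅ ε)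
Groups⇒⊴ (dt-start g) = ∷-⊴ _ (Groups⇒⊴ g)
Groups⇒⊴ (dt-extend g) = ∷-⊴ _ (Groups⇒⊴ g) ◅◅ (here-nd ◅ ε)
Groups⇒⊴ (dt-absorb g) = ∷-⊴ _ (Groups⇒⊴ g) ◅◅ (here-dn ◅ ε)

Groups-refl : ∀ {c} → Column c → Groups c c
Groups-refl [] = []
Groups-refl {nd _ ∷ _} (refl ∷ col) = nd-start (Groups-refl col)
Groups-refl {dt _ ∷ _} (_ ∷ col) = dt-start (Groups-refl col)

column-⊴-≼ : ∀ {c β δ} → Column c → c ⊴ β → δ ≼ β → c ⊴ δ
column-⊴-≼ col c⊴β δ≼β = Groups⇒⊴ (Groups-≼ (Groups-⊴ (Groups-refl col) c⊴β) δ≼β)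

Column-reverse : ∀ {α} → Column α → Column (Rev α)
Column-reverse col = All.tabulate λ p∈ → All.lookup col (Any.reverse⁻ p∈)

column-≺₁-minimal : ∀ {β α} → Column α → ¬ (β ≺₁ α)
column-≺₁-minimal (() ∷ _) here
column-≺₁-minimal (_ ∷ col) (there s) = column-≺₁-minimal col s

column-≼-minimal : ∀ {β α} → Column α → β ≼ α → β ≡ α
column-≼-minimal col ε = refl
column-≼-minimal col (s ◅ ss) with column-≼-minimal col ss
... | refl = ⊥-elim (column-≺₁-minimal col s)

L-column : ∀ {α} (E : Enum (λ β → β ≼ α)) → Column α → L α E ≡ M α
L-column E col = cong sumM (enum-singleton E ε (column-≼-minimal col))

S-M : ∀ up α → S up (M α) ≡ scale (sign α) (sumM (elems (up α)))
S-M up α = trans (++-identityʳ _) (cong (λ s → scale s (sumM (elems (up α)))) (ℤ.*-identityˡ (sign α)))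

sumM-⊴-column : ∀ {c} → Column c →
  (E : Enum (c ⊴_)) (maxs : Enum (λ β → Maximal β × (c ⊴ β))) (down : ∀ β → Enum (_≼ β)) →
  sumM (elems E) ≈ concatMap (λ β → L β (down β)) (elems maxs)
sumM-⊴-column col E maxs down = sumM-partition E maxs down
  (λ {δ} c⊴δ → mergeRuns δ , (Maximal-mergeRuns δ , c⊴δ ◅◅ ≼⇒⊴ (≼-mergeRuns δ)) , ≼-mergeRuns δ)
  (λ (_ , c⊴β) δ≼β → column-⊴-≼ col c⊴β δ≼β)
  (λ (m , _) δ≼β (m′ , _) δ≼β′ → trans (maximal-above-unique δ≼β m) (sym (maximal-above-unique δ≼β′ m′)))

mainTheorem6 : (up : (β : DComp) → Enum (λ γ → Rev β ⊴ γ))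
    (down : (β : DComp) → Enum (λ δ → δ ≼ β))
    (α : DComp) → Column α →
    (maxs : Enum (λ β → Maximal β × (Rev α ⊴ β))) →
    S up (L α (down α))
    ≈ scale (sign α) (concatMap (λ β → L β (down β)) (elems maxs))
mainTheorem6 up down α col maxs δ = begin
  coeff (S up (L α (down α))) δ     ≡⟨ cong (λ x → coeff (S up x) δ) (L-column (down α) col) ⟩
  coeff (S up (M α)) δ              ≡⟨ cong (λ x → coeff x δ) (S-M up α) ⟩
  coeff (scale (sign α) ΣM-up) δ    ≡⟨ scale-cong (sign α) {ΣM-up} {ΣL-maxs} partition δ ⟩
  coeff (scale (sign α) ΣL-maxs) δ  ∎
  where
  ΣM-up ΣL-maxs : SQSym
  ΣM-up = sumM (elems (up α))
  ΣL-maxs = concatMap (λ β → L β (down β)) (elems maxs)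

  partition : ΣM-up ≈ ΣL-maxs
  partition = sumM-⊴-column (Column-reverse col) (up α) maxs down
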